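{- For a hypergraph $H$ on a finite set $X$ define $\iota(H),\gamma(H)\in\mathrm{Bool}(X)$ by $\iota(H)(A)=1$ if $A\in E(H)$ and $0$ otherwise, and $\gamma(H)(A)=|\{Y\in E(H):Y\subseteq A\}|$ (so $\gamma(H)=\theta_1(\iota(H))$). Then: (a) $\iota$ is an injective twisted bialgebra morphism from $(\mathbf{HG},m,\Delta)$ to $(\mathbf{Bool},\star_0,\Delta)$; concretely $\iota$ is injective on each $\mathrm{HG}(X)$, commutes with relabellings, $\iota(GH)=\iota(G)\star_0\iota(H)$, and $\iota(G_{\mid Y})=\iota(G)_{\mid Y}$; (b) $\gamma$ is an injective twisted bialgebra morphism from $(\mathbf{HG},m,\Delta)$ to $(\mathbf{Bool}_{\mathrm{r}},\star_1,\Delta)$; concretely, $\gamma(H)$ is rigid for every hypergraph $H$, $\gamma$ is injective, $\gamma(GH)=\gamma(G)\star_1\gamma(H)$ and $\gamma(G_{\mid Y})=\gamma(G)_{\mid Y}$; (c) $\epsilon_\delta(\gamma(H))=\epsilon_\delta(H)$ for every hypergraph $H$.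
   Context: A boolean function on $X$ is $f:\mathcal{P}(X)\to\mathbb{Z}$ with $f(\emptyset)=0$; $\mathrm{Bool}(X)$ is their set, $\mathbf{Bool}$ its linearization. A hypergraph $H$ on $X$ is a set $E(H)\subseteq\mathcal{P}(X)$ of hyperedges not containing $\emptyset$; $\mathrm{HG}(X)$ their set, $\mathbf{HG}$ its linearization. For disjoint $X,Y$, $G\in\mathrm{HG}(X)$, $H\in\mathrm{HG}(Y)$: $E(GH)=E(G)\sqcup E(H)$; for $Y\subseteq X$, $E(G_{\mid Y})=\{Z\in E(G):Z\subseteq Y\}$; the coproduct on $\mathbf{HG}$ is $\Delta_{X,Y}(G)=G_{\mid X}\otimes G_{\mid Y}$. On $\mathbf{Bool}$: $\Delta_{X,Y}(f)=f_{\mid X}\otimes f_{\mid Y}$ (restrictions), $f\star_1 g(A)=f(A\cap X)+g(A\cap Y)$, and $f\star_0g(A)=f(A)$ if $A\subseteq X$, $g(A)$ if $A\subseteq Y$, $0$ otherwise. $\theta_1(f)(A)=\sum_{B\subseteq A}f(B)$. $f$ is indecomposable (nonempty $X$) if $f=f'\star_1f''$ with $f'\in\mathrm{Bool}(X\setminus Y)$, $f''\in\mathrm{Bool}(Y)$ forces $Y\in\{\emptyset,X\}$; every $f$ is uniquely the $\star_1$-product of its restrictions to its indecomposable components, each indecomposable. An indecomposable $f$ is rigid if for disjoint $A,B$ with $f(A\sqcup B)=f(A)+f(B)$, $f(A'\sqcup B')=f(A')+f(B')$ for all $A'\subseteq A$, $B'\subseteq B$; a general $f$ is rigid if its restrictions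 to its indecomposable components are rigid; $\mathbf{Bool}_{\mathrm{r}}$ is the linear span of rigid boolean functions. $\epsilon_\delta(f)=1$ if $f$ is modular (i.e. $f(A)=\sum_{x\in A}f(\{x\})$ for all $A$) and $0$ otherwise; for a hypergraph, $\epsilon_\delta(H)=1$ if every hyperedge has cardinality $1$ and $0$ otherwise. -}

module Defs where

open import Data.Nat using (ℕ; zero; suc)
open import Data.Bool using (Bool; true; false; if_then_else_; _∨_; _∧_)
open import Data.Fin using (Fin; zero; suc)
open import Data.Fin.Subset using (Subset; ⊥; _⊆_; _∩_; _∪_; _─_; ⁅_⁆; ∣_∣; Nonempty)
open import Data.Fin.Subset.Properties using (_⊆?_)
open import Data.Fin.Permutation using (Permutation; _⟨$⟩ʳ_; _⟨$⟩ˡ_)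
open import Data.Vec using (Vec; []; _∷_; lookup; tabulate)
open import Data.List using (List; []; _∷_; _++_; map; filter; length)
open import Data.Integer using (ℤ; +_; _+_)
open import Data.Product using (Σ; _×_; ∃₂)
open import Data.Sum using (_⊎_)
open import Relation.Nullary.Decidable using (_×-dec_; does)
open import Relation.Binary.PropositionalEquality using (_≡_)
open import Data.Bool.Properties using (T?)
open import Data.Bool using (T)

-- Finite sets are modelled as subsets X of an ambient finite set Fin n
-- (subsets of Fin n are Data.Fin.Subset.Subset n = Vec Bool n).

HGraph : ℕ → Set
HGraph n = Subset n → Bool

IsHG : ∀ {n} → Subset n → HGraph n → Set
IsHG X H = (H ⊥ ≡ false) × (∀ A → H A ≡ true → A ⊆ X)

_·HG_ : ∀ {n} → HGraph n → HGraph n → HGraph n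
(G ·HG H) A = G A ∨ H A

_∣HG_ : ∀ {n} → HGraph n → Subset n → HGraph n
(G ∣HG Y) A = G A ∧ does (A ⊆? Y)

AllSingletons : ∀ {n} → HGraph n → Set
AllSingletons H = ∀ A → H A ≡ true → ∣ A ∣ ≡ 1

-- Boolean functions : f : P(X) → ℤ with f(∅) = 0; only the values on
-- subsets of X matter.

BoolFn : ℕ → Set
BoolFn n = Subset n → ℤ

IsBoolFn : ∀ {n} → Subset n → BoolFn n → Set
IsBoolFn X f = f ⊥ ≡ + 0

star0 : ∀ {n} → Subset n → Subset n → BoolFn n → BoolFn n → BoolFn n
star0 X Y f g A =
  if does (A ⊆? X) then f A else (if does (A ⊆? Y) then g A else + 0)

star1 : ∀ {n} → Subset n → Subset n → BoolFn n → BoolFn n → BoolFn n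
star1 X Y f g A = f (A ∩ X) + g (A ∩ Y)

DecomposesAlong : ∀ {n} → Subset n → BoolFn n → Subset n → Set
DecomposesAlong {n} X f Y =
  ∃₂ λ (f' f'' : BoolFn n) → IsBoolFn (X ─ Y) f' × IsBoolFn Y f'' ×
     (∀ A → A ⊆ X → f A ≡ star1 (X ─ Y) Y f' f'' A)

Indecomposable : ∀ {n} → Subset n → BoolFn n → Set
Indecomposable X f = Nonempty X ×
  (∀ Y → Y ⊆ X → DecomposesAlong X f Y → (Y ≡ ⊥) ⊎ (Y ≡ X))

IsComponent : ∀ {n} → Subset n → BoolFn n → Subset n → Set
IsComponent X f C = C ⊆ X × DecomposesAlong X f C × Indecomposable C f

Disjoint : ∀ {n} → Subset n → Subset n → Set
Disjoint A B = A ∩ B ≡ ⊥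

RigidIndec : ∀ {n} → Subset n → BoolFn n → Set
RigidIndec X f = ∀ A B → A ⊆ X → B ⊆ X → Disjoint A B →
  f (A ∪ B) ≡ f A + f B →
  ∀ A' B' → A' ⊆ A → B' ⊆ B → f (A' ∪ B') ≡ f A' + f B'

Rigid : ∀ {n} → Subset n → BoolFn n → Set
Rigid X f = ∀ C → IsComponent X f C → RigidIndec C f

sumOver : ∀ {n} → Subset n → (Fin n → ℤ) → ℤ
sumOver {zero} [] g = + 0
sumOver {suc n} (b ∷ A) g = (if b then g zero else + 0) + sumOver A (λ i → g (suc i))

Modular : ∀ {n} → Subset n → BoolFn n → Set
Modular X f = ∀ A → A ⊆ X → f A ≡ sumOver A (λ x → f ⁅ x ⁆)

allSubsets : ∀ n → List (Subset n)
allSubsets zero = [] ∷ []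
allSubsets (suc n) = map (false ∷_) (allSubsets n) ++ map (true ∷_) (allSubsets n)

ι : ∀ {n} → HGraph n → BoolFn n
ι H A = if H A then + 1 else + 0

γ : ∀ {n} → HGraph n → BoolFn n
γ {n} H A = + length (filter (λ Y → (Y ⊆? A) ×-dec T? (H Y)) (allSubsets n))

image : ∀ {m n} → Permutation m n → Subset m → Subset n
image π A = tabulate (λ j → lookup A (π ⟨$⟩ˡ j))

preimage : ∀ {m n} → Permutation m n → Subset n → Subset m
preimage π B = tabulate (λ i → lookup B (π ⟨$⟩ʳ i))

relabelHG : ∀ {m n} → Permutation m n → HGraph m → HGraph n
relabelHG π H B = H (preimage π B)

relabelBool : ∀ {m n} → Permutation m n → BoolFn m → BoolFn n
relabelBool π f B = f (preimage π B)

{-# OPTIONS --safe #-}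
-- γ H A counts the hyperedges of H contained in A, so each claim about γ is a counting identity for
-- sums over the subsets of Fin n. For disjoint A and B, the edges inside A ∪ B are those inside A,
-- those inside B and those crossing (A , B); hence γ H is additive on (A , B) exactly when no edge
-- crosses, a property inherited by subpairs (rigidity) and automatic when all edges are singletons
-- (modularity). Besides edges in proper subsets of A, γ H A counts A itself exactly when it is an
-- edge, so H is recovered from γ H by well-founded induction on ⊂. Relabelling reindexes the sum
-- along the bijection that the permutation induces on subsets.
module Submission where

open import Defs
open import Level using (Level)
open import Data.Bool using (Bool; true; false; not; _∧_; _∨_; if_then_else_; T)
open import Data.Bool.Properties using (T-∧; T-∨; T-≡; ∧-identityʳ; ∨-identityʳ) renaming (_≟_ to _≟ᵇ_)
open import Data.Nat using (ℕ; zero; suc; _+_; _≤_; _<_; _≡ᵇ_; z≤n)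
import Data.Nat.Properties as ℕ
open import Algebra.Properties.CommutativeSemigroup ℕ.+-commutativeSemigroup using (interchange)
open import Data.Integer using (ℤ; +_) renaming (_+_ to _+ℤ_)
import Data.Integer.Properties as ℤ
open import Data.Fin using (Fin; zero; suc)
open import Data.Fin.Subset using (Subset; ⊥; ⁅_⁆; _∈_; _∉_; _⊆_; _⊂_; _∩_; _∪_; ∣_∣)
open import Data.Fin.Subset.Properties
  using (_⊆?_; _⊂?_; _∈?_; ⊆-trans; ⊆-antisym; ⊥⊆; ∉⊥; p⊆p∪q; q⊆p∪q; x∈p∪q⁺; x∈p∪q⁻; x∈p∩q⁺;
         p∩q⊆p; p∩q⊆q; x∈⁅x⁆; x∈⁅y⁆⇒x≡y; ∣⁅x⁆∣≡1; out⊂; out⊂in; s⊂s; drop-∷-⊆; ⊂-irref;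
         p⊂q⇒p⊆q; p⊂q⇒∣p∣<∣q∣; ∪-identityˡ; ∩-zeroˡ)
open import Data.Fin.Permutation using (Permutation; _⟨$⟩ʳ_; _⟨$⟩ˡ_; inverseˡ; inverseʳ)
open import Data.List using ([]; _∷_; _++_; map; filter; length)
open import Data.List.Properties using (filter-++; length-++)
open import Data.Vec using ([]; _∷_; here; tabulate; lookup)
open import Data.Vec.Properties
  using (≡-dec; lookup∘tabulate; tabulate∘lookup; tabulate-cong; []=⇒lookup; lookup⇒[]=)
open import Data.Product using (∃; _×_; _,_; proj₁; proj₂)
open import Data.Empty using (⊥-elim)
open import Data.Sum using (_⊎_; inj₁; inj₂; [_,_]′)
open import Function using (_∘_; id)
open import Function.Bundles using (_⇔_; mk⇔; _↔_; mk↔ₛ′; Inverse; Equivalence)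
open import Data.Nat.Induction using (<-wellFounded)
open import Induction.WellFounded using (WellFounded; module Subrelation; module All)
import Relation.Binary.Construct.On as On
open import Relation.Binary.Definitions using (DecidableEquality)
open import Relation.Binary.PropositionalEquality
  using (_≡_; _≢_; refl; sym; trans; cong; cong₂; subst; module ≡-Reasoning)
open import Relation.Nullary using (yes; no; ¬_; does; contradiction)
open import Relation.Nullary.Decidable using (_×-dec_; _⊎-dec_; ¬?; T?; does-⇔; dec-true)
open import Relation.Unary using (Pred; Decidable)

open ≡-Reasoning

private variable
  ℓ : Level
  m n : ℕ

𝟙 : Bool → ℕ
𝟙 b = if b then 1 else 0

𝟙-injective : ∀ {a b} → 𝟙 a ≡ 𝟙 b → a ≡ b
𝟙-injective {true}  {true}  _ = refl
𝟙-injective {false} {false} _ = refl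

T⇒≡ : ∀ {b} → T b → b ≡ true
T⇒≡ = Equivalence.to T-≡

≡⇒T : ∀ {b} → b ≡ true → T b
≡⇒T = Equivalence.from T-≡

m+n≡m⇒n≡0 : ∀ m {n} → m + n ≡ m → n ≡ 0
m+n≡m⇒n≡0 m {n} m+n≡m = ℕ.+-cancelˡ-≡ m n 0 (trans m+n≡m (sym (ℕ.+-identityʳ m)))

∑ : (Subset n → ℕ) → ℕ
∑ {zero}  f = f []
∑ {suc n} f = ∑ (f ∘ (false ∷_)) + ∑ (f ∘ (true ∷_))

∑-cong : {f g : Subset n → ℕ} → (∀ Y → f Y ≡ g Y) → ∑ f ≡ ∑ g
∑-cong {zero}  f≗g = f≗g []
∑-cong {suc n} f≗g = cong₂ _+_ (∑-cong (f≗g ∘ (false ∷_))) (∑-cong (f≗g ∘ (true ∷_)))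

∑-zero : ∑ {n} (λ _ → 0) ≡ 0
∑-zero {zero}  = refl
∑-zero {suc n} = cong₂ _+_ (∑-zero {n}) (∑-zero {n})

∑-+ : (f g : Subset n → ℕ) → ∑ (λ Y → f Y + g Y) ≡ ∑ f + ∑ g
∑-+ {zero}  f g = refl
∑-+ {suc n} f g = trans
  (cong₂ _+_ (∑-+ (f ∘ (false ∷_)) (g ∘ (false ∷_))) (∑-+ (f ∘ (true ∷_)) (g ∘ (true ∷_))))
  (interchange (∑ (f ∘ (false ∷_))) (∑ (g ∘ (false ∷_))) (∑ (f ∘ (true ∷_))) (∑ (g ∘ (true ∷_))))

∑-mono : {f g : Subset n → ℕ} → (∀ Y → f Y ≤ g Y) → ∑ f ≤ ∑ g
∑-mono {zero}  f≤g = f≤g []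
∑-mono {suc n} f≤g = ℕ.+-mono-≤ (∑-mono (f≤g ∘ (false ∷_))) (∑-mono (f≤g ∘ (true ∷_)))

∑-swap : ∀ {m n} (f : Subset m → Subset n → ℕ) → ∑ (λ Y → ∑ (f Y)) ≡ ∑ (λ Z → ∑ (λ Y → f Y Z))
∑-swap {zero}  f = refl
∑-swap {suc m} {n} f = begin
  ∑ (λ Y → ∑ (f (false ∷ Y))) + ∑ (λ Y → ∑ (f (true ∷ Y)))
    ≡⟨ cong₂ _+_ (∑-swap (f ∘ (false ∷_))) (∑-swap (f ∘ (true ∷_))) ⟩
  ∑ (λ Z → ∑ (λ Y → f (false ∷ Y) Z)) + ∑ (λ Z → ∑ (λ Y → f (true ∷ Y) Z))
    ≡⟨ ∑-+ {n} (λ Z → ∑ (λ Y → f (false ∷ Y) Z)) (λ Z → ∑ (λ Y → f (true ∷ Y) Z)) ⟨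
  ∑ (λ Z → ∑ (λ Y → f Y Z)) ∎

_≟_ : DecidableEquality (Subset n)
_≟_ = ≡-dec _≟ᵇ_

∑-δ : ∀ Z (g : Subset n → ℕ) → ∑ (λ Y → if does (Y ≟ Z) then g Y else 0) ≡ g Z
∑-δ {zero}  []          g = refl
∑-δ {suc n} (false ∷ Z) g = trans (cong₂ _+_ (∑-δ Z (g ∘ (false ∷_))) (∑-zero {n})) (ℕ.+-identityʳ _)
∑-δ {suc n} (true ∷ Z)  g = cong₂ _+_ (∑-zero {n}) (∑-δ Z (g ∘ (true ∷_)))

-- Double counting: both sides equal ∑ over pairs (Y , Z) with Z = φ Y of f Z.
∑-reindex : (φ : Subset m ↔ Subset n) (f : Subset n → ℕ) → ∑ (f ∘ Inverse.to φ) ≡ ∑ f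
∑-reindex φ f = begin
  ∑ (f ∘ to)
    ≡⟨ ∑-cong (λ Y → ∑-δ (to Y) f) ⟨
  ∑ (λ Y → ∑ (λ Z → if does (Z ≟ to Y) then f Z else 0))
    ≡⟨ ∑-swap (λ Y Z → if does (Z ≟ to Y) then f Z else 0) ⟩
  ∑ (λ Z → ∑ (λ Y → if does (Z ≟ to Y) then f Z else 0))
    ≡⟨ ∑-cong (λ Z → ∑-cong (λ Y → cong (if_then f Z else 0) (graph Y Z))) ⟩
  ∑ (λ Z → ∑ (λ Y → if does (Y ≟ from Z) then f Z else 0))
    ≡⟨ ∑-cong (λ Z → ∑-δ (from Z) (λ _ → f Z)) ⟩
  ∑ f ∎
  where
  open Inverse φ using (to; from; strictlyInverseˡ; strictlyInverseʳ)
  graph : ∀ Y Z → does (Z ≟ to Y) ≡ does (Y ≟ from Z)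
  graph Y Z = does-⇔
    (mk⇔ (λ { refl → sym (strictlyInverseʳ Y) }) (λ { refl → sym (strictlyInverseˡ Z) }))
    (Z ≟ to Y) (Y ≟ from Z)

count : {P : Pred (Subset n) ℓ} → Decidable P → ℕ
count P? = ∑ (λ Y → 𝟙 (does (P? Y)))

length-filter-allSubsets : {P : Pred (Subset n) ℓ} (P? : Decidable P) →
                           length (filter P? (allSubsets n)) ≡ count P?
length-filter-allSubsets {zero} P? with does (P? [])
... | true  = refl
... | false = refl
length-filter-allSubsets {suc n} P? = begin
  length (filter P? (map (false ∷_) (allSubsets n) ++ map (true ∷_) (allSubsets n)))
    ≡⟨ cong length (filter-++ P? (map (false ∷_) (allSubsets n)) (map (true ∷_) (allSubsets n))) ⟩
  length (filter P? (map (false ∷_) (allSubsets n)) ++ filter P? (map (true ∷_) (allSubsets n)))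
    ≡⟨ length-++ (filter P? (map (false ∷_) (allSubsets n))) ⟩
  length (filter P? (map (false ∷_) (allSubsets n))) + length (filter P? (map (true ∷_) (allSubsets n)))
    ≡⟨ cong₂ _+_ (length-filter-map (false ∷_) (allSubsets n)) (length-filter-map (true ∷_) (allSubsets n)) ⟩
  length (filter (P? ∘ (false ∷_)) (allSubsets n)) + length (filter (P? ∘ (true ∷_)) (allSubsets n))
    ≡⟨ cong₂ _+_ (length-filter-allSubsets (P? ∘ (false ∷_))) (length-filter-allSubsets (P? ∘ (true ∷_))) ⟩
  count P? ∎
  where
  length-filter-map : ∀ (h : Subset n → Subset (suc n)) xs →
                      length (filter P? (map h xs)) ≡ length (filter (P? ∘ h) xs)
  length-filter-map h []       = refl
  length-filter-map h (x ∷ xs) with does (P? (h x))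
  ... | true  = cong suc (length-filter-map h xs)
  ... | false = length-filter-map h xs

module _ {P : Pred (Subset n) ℓ} {Q : Pred (Subset n) ℓ} (P? : Decidable P) (Q? : Decidable Q) where

  count-cong : (∀ {Y} → P Y ⇔ Q Y) → count P? ≡ count Q?
  count-cong P⇔Q = ∑-cong (λ Y → cong 𝟙 (does-⇔ P⇔Q (P? Y) (Q? Y)))

  count-mono : (∀ {Y} → P Y → Q Y) → count P? ≤ count Q?
  count-mono P⇒Q = ∑-mono pointwise
    where
    pointwise : ∀ Y → 𝟙 (does (P? Y)) ≤ 𝟙 (does (Q? Y))
    pointwise Y with P? Y | Q? Y
    ... | yes p | no ¬q = contradiction (P⇒Q p) ¬q
    ... | yes _ | yes _ = ℕ.≤-refl
    ... | no _  | _     = z≤n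

  count-⊎ : (∀ {Y} → P Y → ¬ Q Y) → count (λ Y → P? Y ⊎-dec Q? Y) ≡ count P? + count Q?
  count-⊎ P⇒¬Q = trans (∑-cong pointwise) (∑-+ (λ Y → 𝟙 (does (P? Y))) (λ Y → 𝟙 (does (Q? Y))))
    where
    pointwise : ∀ Y → 𝟙 (does (P? Y ⊎-dec Q? Y)) ≡ 𝟙 (does (P? Y)) + 𝟙 (does (Q? Y))
    pointwise Y with P? Y | Q? Y
    ... | yes p | yes q = contradiction q (P⇒¬Q p)
    ... | yes _ | no _  = refl
    ... | no _  | yes _ = refl
    ... | no _  | no _  = refl

count-≡0 : {P : Pred (Subset n) ℓ} (P? : Decidable P) → (∀ {Y} → ¬ P Y) → count P? ≡ 0
count-≡0 {n = n} P? ¬P = trans (∑-cong pointwise) (∑-zero {n})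
  where
  pointwise : ∀ Y → 𝟙 (does (P? Y)) ≡ 0
  pointwise Y with P? Y
  ... | yes p = contradiction p ¬P
  ... | no _  = refl

count-at : {P : Pred (Subset n) ℓ} (P? : Decidable P) (Z : Subset n) →
           count (λ Y → (Y ≟ Z) ×-dec P? Y) ≡ 𝟙 (does (P? Z))
count-at P? Z = trans (∑-cong pointwise) (∑-δ Z (λ Y → 𝟙 (does (P? Y))))
  where
  pointwise : ∀ Y → 𝟙 (does (Y ≟ Z) ∧ does (P? Y)) ≡ (if does (Y ≟ Z) then 𝟙 (does (P? Y)) else 0)
  pointwise Y with does (Y ≟ Z)
  ... | true  = refl
  ... | false = refl

∉-disjoint : ∀ {A B : Subset n} {x} → Disjoint A B → x ∈ A → x ∉ B
∉-disjoint {x = x} A∩B≡⊥ x∈A x∈B = ∉⊥ (subst (x ∈_) A∩B≡⊥ (x∈p∩q⁺ (x∈A , x∈B)))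

⊆-disjoint⇒≡⊥ : ∀ {A B Y : Subset n} → Disjoint A B → Y ⊆ A → Y ⊆ B → Y ≡ ⊥
⊆-disjoint⇒≡⊥ A∩B≡⊥ Y⊆A Y⊆B = ⊆-antisym (λ x∈Y → contradiction (Y⊆B x∈Y) (∉-disjoint A∩B≡⊥ (Y⊆A x∈Y))) ⊥⊆

⊆∪⇒⊆ˡ : ∀ {A B Y : Subset n} → Y ⊆ A ∪ B → (∀ {x} → x ∈ Y → x ∉ B) → Y ⊆ A
⊆∪⇒⊆ˡ {A = A} {B} Y⊆A∪B Y∌B x∈Y =
  [ id , (λ x∈B → contradiction x∈B (Y∌B x∈Y)) ]′ (x∈p∪q⁻ A B (Y⊆A∪B x∈Y))

⊆∪⇒⊆ʳ : ∀ {A B Y : Subset n} → Y ⊆ A ∪ B → (∀ {x} → x ∈ Y → x ∉ A) → Y ⊆ B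
⊆∪⇒⊆ʳ {A = A} {B} Y⊆A∪B Y∌A x∈Y =
  [ (λ x∈A → contradiction x∈A (Y∌A x∈Y)) , id ]′ (x∈p∪q⁻ A B (Y⊆A∪B x∈Y))

∪-mono-⊆ : ∀ {A B A′ B′ : Subset n} → A′ ⊆ A → B′ ⊆ B → A′ ∪ B′ ⊆ A ∪ B
∪-mono-⊆ {A = A} {B} {A′} {B′} A′⊆A B′⊆B x∈A′∪B′ =
  x∈p∪q⁺ (Data.Sum.map A′⊆A B′⊆B (x∈p∪q⁻ A′ B′ x∈A′∪B′))

⊆∧≢⇒⊂ : ∀ {p q : Subset n} → p ⊆ q → p ≢ q → p ⊂ q
⊆∧≢⇒⊂ {p = []}        {[]}        _   p≢q = contradiction refl p≢q
⊆∧≢⇒⊂ {p = false ∷ p} {false ∷ q} p⊆q p≢q = out⊂ (⊆∧≢⇒⊂ (drop-∷-⊆ p⊆q) (p≢q ∘ cong (false ∷_)))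
⊆∧≢⇒⊂ {p = false ∷ p} {true ∷ q}  p⊆q _   = out⊂in (drop-∷-⊆ p⊆q)
⊆∧≢⇒⊂ {p = true ∷ p}  {true ∷ q}  p⊆q p≢q = s⊂s (⊆∧≢⇒⊂ (drop-∷-⊆ p⊆q) (p≢q ∘ cong (true ∷_)))
⊆∧≢⇒⊂ {p = true ∷ p}  {false ∷ q} p⊆q _   with () ← p⊆q here

⊂-wellFounded : WellFounded (_⊂_ {n})
⊂-wellFounded = Subrelation.wellFounded p⊂q⇒∣p∣<∣q∣ (On.wellFounded ∣_∣ <-wellFounded)

x∈p⇒⁅x⁆⊆p : ∀ {p : Subset n} {x} → x ∈ p → ⁅ x ⁆ ⊆ p
x∈p⇒⁅x⁆⊆p {x = x} x∈p y∈⁅x⁆ = subst (_∈ _) (sym (x∈⁅y⁆⇒x≡y x y∈⁅x⁆)) x∈p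

⊆⁅x⁆⇒≡⊥⊎≡⁅x⁆ : ∀ {p : Subset n} {x} → p ⊆ ⁅ x ⁆ → p ≡ ⊥ ⊎ p ≡ ⁅ x ⁆
⊆⁅x⁆⇒≡⊥⊎≡⁅x⁆ {p = p} {x} p⊆⁅x⁆ with x ∈? p
... | yes x∈p = inj₂ (⊆-antisym p⊆⁅x⁆ (x∈p⇒⁅x⁆⊆p x∈p))
... | no  x∉p = inj₁ (⊆-antisym (λ y∈p → contradiction (subst (_∈ p) (x∈⁅y⁆⇒x≡y x (p⊆⁅x⁆ y∈p)) y∈p) x∉p) ⊥⊆)

∣p∣≡1⇒≡⁅x⁆ : ∀ {p : Subset n} → ∣ p ∣ ≡ 1 → ∃ λ x → p ≡ ⁅ x ⁆
∣p∣≡1⇒≡⁅x⁆ {p = false ∷ p} ∣p∣≡1 with ∣p∣≡1⇒≡⁅x⁆ {p = p} ∣p∣≡1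
... | x , p≡⁅x⁆ = suc x , cong (false ∷_) p≡⁅x⁆
∣p∣≡1⇒≡⁅x⁆ {p = true ∷ p} ∣p∣≡1 = zero , cong (true ∷_) (∣p∣≡0⇒≡⊥ (ℕ.suc-injective ∣p∣≡1))
  where
  ∣p∣≡0⇒≡⊥ : ∀ {n} {p : Subset n} → ∣ p ∣ ≡ 0 → p ≡ ⊥
  ∣p∣≡0⇒≡⊥ {p = []}        _ = refl
  ∣p∣≡0⇒≡⊥ {p = false ∷ p} e = cong (false ∷_) (∣p∣≡0⇒≡⊥ e)

∈-tabulate-lookup : ∀ (h : Fin m → Fin n) {p : Subset n} {x} → x ∈ tabulate (lookup p ∘ h) ⇔ h x ∈ p
∈-tabulate-lookup h {p} {x} = mk⇔
  (λ x∈ → lookup⇒[]= (h x) p (trans (sym (lookup∘tabulate (lookup p ∘ h) x)) ([]=⇒lookup x∈)))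
  (λ hx∈p → lookup⇒[]= x _ (trans (lookup∘tabulate (lookup p ∘ h) x) ([]=⇒lookup hx∈p)))

module _ (π : Permutation m n) where

  preimage-image : ∀ p → preimage π (image π p) ≡ p
  preimage-image p = trans
    (tabulate-cong (λ i → trans (lookup∘tabulate _ (π ⟨$⟩ʳ i)) (cong (lookup p) (inverseˡ π))))
    (tabulate∘lookup p)

  image-preimage : ∀ q → image π (preimage π q) ≡ q
  image-preimage q = trans
    (tabulate-cong (λ j → trans (lookup∘tabulate _ (π ⟨$⟩ˡ j)) (cong (lookup q) (inverseʳ π))))
    (tabulate∘lookup q)

  preimage-↔ : Subset n ↔ Subset m
  preimage-↔ = mk↔ₛ′ (preimage π) (image π) preimage-image image-preimage

  preimage-⊆⇔ : ∀ {p q} → preimage π p ⊆ preimage π q ⇔ p ⊆ q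
  preimage-⊆⇔ {p} {q} = mk⇔
    (λ πp⊆πq {x} x∈p → subst (_∈ q) (inverseʳ π) (to (∈-tabulate-lookup (π ⟨$⟩ʳ_))
      (πp⊆πq (from (∈-tabulate-lookup (π ⟨$⟩ʳ_)) (subst (_∈ p) (sym (inverseʳ π)) x∈p)))))
    (λ p⊆q {x} x∈πp → from (∈-tabulate-lookup (π ⟨$⟩ʳ_)) (p⊆q (to (∈-tabulate-lookup (π ⟨$⟩ʳ_)) x∈πp)))
    where open Equivalence

edge≢⊥ : ∀ {H : HGraph n} {Y} → H ⊥ ≡ false → H Y ≡ true → Y ≢ ⊥
edge≢⊥ H⊥≡false HY≡true refl = contradiction (trans (sym H⊥≡false) HY≡true) λ ()

nonedge-outside : ∀ {X A : Subset n} {H} → IsHG X H → ¬ A ⊆ X → H A ≡ false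
nonedge-outside {A = A} {H} (_ , edges⊆X) A⊈X with H A in HA
... | true  = ⊥-elim (A⊈X (edges⊆X A HA))
... | false = refl

nonedge-disjoint : ∀ {X Y A : Subset n} {H} → Disjoint X Y → IsHG Y H → A ⊆ X → H A ≡ false
nonedge-disjoint {A = A} {H} X∩Y≡⊥ (H⊥≡false , edges⊆Y) A⊆X with H A in HA
... | true  = contradiction (⊆-disjoint⇒≡⊥ X∩Y≡⊥ A⊆X (edges⊆Y A HA)) (edge≢⊥ H⊥≡false HA)
... | false = refl

hypergraph-ext : ∀ {X : Subset n} {G H} → IsHG X G → IsHG X H →
                 (∀ A → A ⊆ X → G A ≡ H A) → ∀ A → G A ≡ H A
hypergraph-ext {X = X} hG hH G≡H A with A ⊆? X
... | yes A⊆X = G≡H A A⊆X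
... | no  A⊈X = trans (nonedge-outside hG A⊈X) (sym (nonedge-outside hH A⊈X))

ι-·HG : ∀ {X Y : Subset n} {G H} → Disjoint X Y → IsHG X G → IsHG Y H →
        ∀ A → ι (G ·HG H) A ≡ star0 X Y (ι G) (ι H) A
ι-·HG {X = X} {Y} {G} {H} X∩Y≡⊥ hG hH A with A ⊆? X
... | yes A⊆X = cong (if_then + 1 else + 0)
                  (trans (cong (G A ∨_) (nonedge-disjoint X∩Y≡⊥ hH A⊆X)) (∨-identityʳ (G A)))
... | no  A⊈X with A ⊆? Y
...   | yes _   = cong (if_then + 1 else + 0) (cong (_∨ H A) (nonedge-outside hG A⊈X))
...   | no  A⊈Y = cong (if_then + 1 else + 0)
                    (trans (cong (_∨ H A) (nonedge-outside hG A⊈X)) (nonedge-outside hH A⊈Y))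

ι-∣HG : ∀ {Y A : Subset n} {G} → A ⊆ Y → ι (G ∣HG Y) A ≡ ι G A
ι-∣HG {Y = Y} {A} {G} A⊆Y = cong (if_then + 1 else + 0)
  (trans (cong (G A ∧_) (dec-true (A ⊆? Y) A⊆Y)) (∧-identityʳ (G A)))

ι-injective : ∀ {X : Subset n} {G H} → IsHG X G → IsHG X H →
              (∀ A → A ⊆ X → ι G A ≡ ι H A) → ∀ A → G A ≡ H A
ι-injective {G = G} {H} hG hH ιG≡ιH = hypergraph-ext hG hH (λ A A⊆X → if-injective (ιG≡ιH A A⊆X))
  where
  if-injective : ∀ {a b} → (if a then + 1 else + 0) ≡ (if b then + 1 else + 0) → a ≡ b
  if-injective {true}  {true}  _ = refl
  if-injective {false} {false} _ = refl

EdgeIn : HGraph n → Subset n → Pred (Subset n) _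
EdgeIn H A Y = Y ⊆ A × T (H Y)

edgeIn? : (H : HGraph n) (A : Subset n) → Decidable (EdgeIn H A)
edgeIn? H A Y = (Y ⊆? A) ×-dec T? (H Y)

edgesIn : HGraph n → Subset n → ℕ
edgesIn H A = count (edgeIn? H A)

γ≡edgesIn : (H : HGraph n) (A : Subset n) → γ H A ≡ + edgesIn H A
γ≡edgesIn H A = cong +_ (length-filter-allSubsets (edgeIn? H A))

γ≡⇒edgesIn≡ : ∀ {G H : HGraph n} {A B} → γ G A ≡ γ H B → edgesIn G A ≡ edgesIn H B
γ≡⇒edgesIn≡ {G = G} {H} {A} {B} γG≡γH =
  ℤ.+-injective (trans (sym (γ≡edgesIn G A)) (trans γG≡γH (γ≡edgesIn H B)))

edgesIn≡⇒γ≡ : ∀ {G : HGraph m} {H : HGraph n} {A B} → edgesIn G A ≡ edgesIn H B → γ G A ≡ γ H B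
edgesIn≡⇒γ≡ {G = G} {H} {A} {B} eq = trans (γ≡edgesIn G A) (trans (cong +_ eq) (sym (γ≡edgesIn H B)))

edgesIn-cong : ∀ {G H : HGraph n} {A} → (∀ Y → G Y ≡ H Y) → edgesIn G A ≡ edgesIn H A
edgesIn-cong {A = A} G≗H = ∑-cong (λ Y → cong (λ b → 𝟙 (does (Y ⊆? A) ∧ b)) (G≗H Y))

edgesIn-·HG : ∀ {G H : HGraph n} {A} → (∀ {Y} → T (G Y) → ¬ T (H Y)) →
              edgesIn (G ·HG H) A ≡ edgesIn G A + edgesIn H A
edgesIn-·HG {G = G} {H} {A} G∩H≡∅ = begin
  edgesIn (G ·HG H) A
    ≡⟨ count-cong (edgeIn? (G ·HG H) A) (λ Y → edgeIn? G A Y ⊎-dec edgeIn? H A Y) (mk⇔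
         (λ (Y⊆A , GY∨HY) → Data.Sum.map (Y⊆A ,_) (Y⊆A ,_) (Equivalence.to T-∨ GY∨HY))
         [ Data.Product.map₂ (Equivalence.from T-∨ ∘ inj₁)
         , Data.Product.map₂ (Equivalence.from T-∨ ∘ inj₂) ]′) ⟩
  count (λ Y → edgeIn? G A Y ⊎-dec edgeIn? H A Y)
    ≡⟨ count-⊎ (edgeIn? G A) (edgeIn? H A) (λ (_ , GY) (_ , HY) → G∩H≡∅ GY HY) ⟩
  edgesIn G A + edgesIn H A ∎

edgesIn-∩ : ∀ {X A : Subset n} {H} → (∀ Y → H Y ≡ true → Y ⊆ X) → edgesIn H A ≡ edgesIn H (A ∩ X)
edgesIn-∩ {X = X} {A} {H} edges⊆X = count-cong (edgeIn? H A) (edgeIn? H (A ∩ X)) (mk⇔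
  (λ (Y⊆A , HY) → (λ x∈Y → x∈p∩q⁺ (Y⊆A x∈Y , edges⊆X _ (T⇒≡ HY) x∈Y)) , HY)
  (λ (Y⊆A∩X , HY) → (λ x∈Y → p∩q⊆p A X (Y⊆A∩X x∈Y)) , HY))

edgesIn-∣HG : ∀ {Y A : Subset n} {G} → A ⊆ Y → edgesIn (G ∣HG Y) A ≡ edgesIn G A
edgesIn-∣HG {Y = Y} {A} {G} A⊆Y = count-cong (edgeIn? (G ∣HG Y) A) (edgeIn? G A) λ {Z} → mk⇔
  (Data.Product.map₂ (proj₁ ∘ Equivalence.to T-∧))
  (λ (Z⊆A , GZ) → Z⊆A , Equivalence.from T-∧ (GZ , ≡⇒T (dec-true (Z ⊆? Y) (λ x∈Z → A⊆Y (Z⊆A x∈Z)))))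

edgesIn-⊥ : ∀ {H : HGraph n} → H ⊥ ≡ false → edgesIn H ⊥ ≡ 0
edgesIn-⊥ {H = H} H⊥≡false =
  count-≡0 (edgeIn? H ⊥) (λ (Y⊆⊥ , HY) → edge≢⊥ H⊥≡false (T⇒≡ HY) (⊆-antisym Y⊆⊥ ⊥⊆))

edgesIn-pos : ∀ {H : HGraph n} {Z A} → H Z ≡ true → Z ⊆ A → 0 < edgesIn H A
edgesIn-pos {H = H} {Z} {A} HZ Z⊆A =
  subst (_≤ edgesIn H A) (trans (count-at (T? ∘ H) Z) (cong 𝟙 HZ))
    (count-mono (λ Y → (Y ≟ Z) ×-dec T? (H Y)) (edgeIn? H A) (λ { (refl , HY) → Z⊆A , HY }))

properEdgeIn? : (H : HGraph n) (A : Subset n) → Decidable (λ Y → Y ⊂ A × T (H Y))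
properEdgeIn? H A Y = (Y ⊂? A) ×-dec T? (H Y)

properEdgesIn : HGraph n → Subset n → ℕ
properEdgesIn H A = count (properEdgeIn? H A)

edgesIn-proper : (H : HGraph n) (A : Subset n) → edgesIn H A ≡ properEdgesIn H A + 𝟙 (H A)
edgesIn-proper H A = begin
  edgesIn H A
    ≡⟨ count-cong (edgeIn? H A) (λ Y → properEdgeIn? H A Y ⊎-dec atA? Y) (mk⇔ split
         [ Data.Product.map₁ p⊂q⇒p⊆q , (λ { (refl , HA) → id , HA }) ]′) ⟩
  count (λ Y → properEdgeIn? H A Y ⊎-dec atA? Y)
    ≡⟨ count-⊎ (properEdgeIn? H A) atA? (λ (Y⊂A , _) (Y≡A , _) → ⊂-irref Y≡A Y⊂A) ⟩
  properEdgesIn H A + count atA?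
    ≡⟨ cong (λ k → properEdgesIn H A + k) (count-at (T? ∘ H) A) ⟩
  properEdgesIn H A + 𝟙 (H A) ∎
  where
  atA? : Decidable (λ Y → Y ≡ A × T (H Y))
  atA? Y = (Y ≟ A) ×-dec T? (H Y)
  split : ∀ {Y} → Y ⊆ A × T (H Y) → (Y ⊂ A × T (H Y)) ⊎ (Y ≡ A × T (H Y))
  split {Y} (Y⊆A , HY) with Y ≟ A
  ... | yes Y≡A = inj₂ (Y≡A , HY)
  ... | no  Y≢A = inj₁ (⊆∧≢⇒⊂ Y⊆A Y≢A , HY)

properEdgesIn-cong : ∀ {G H : HGraph n} {A} → (∀ {Y} → Y ⊂ A → G Y ≡ H Y) →
                     properEdgesIn G A ≡ properEdgesIn H A
properEdgesIn-cong {G = G} {H} {A} G≡H = count-cong (properEdgeIn? G A) (properEdgeIn? H A) (mk⇔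
  (λ (Y⊂A , GY) → Y⊂A , subst T (G≡H Y⊂A) GY)
  (λ (Y⊂A , HY) → Y⊂A , subst T (sym (G≡H Y⊂A)) HY))

edgesIn≡⇒≡ : ∀ {G H : HGraph n} {A} → edgesIn G A ≡ edgesIn H A → (∀ {Y} → Y ⊂ A → G Y ≡ H Y) → G A ≡ H A
edgesIn≡⇒≡ {G = G} {H} {A} eq G≡H = 𝟙-injective (ℕ.+-cancelˡ-≡ (properEdgesIn G A) _ _ (begin
  properEdgesIn G A + 𝟙 (G A) ≡⟨ edgesIn-proper G A ⟨
  edgesIn G A                 ≡⟨ eq ⟩
  edgesIn H A                 ≡⟨ edgesIn-proper H A ⟩
  properEdgesIn H A + 𝟙 (H A) ≡⟨ cong (_+ 𝟙 (H A)) (properEdgesIn-cong G≡H) ⟨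
  properEdgesIn G A + 𝟙 (H A) ∎))

CrossingEdge : HGraph n → Subset n → Subset n → Pred (Subset n) _
CrossingEdge H A B Y = EdgeIn H (A ∪ B) Y × ¬ Y ⊆ A × ¬ Y ⊆ B

crossingEdge? : (H : HGraph n) (A B : Subset n) → Decidable (CrossingEdge H A B)
crossingEdge? H A B Y = edgeIn? H (A ∪ B) Y ×-dec ¬? (Y ⊆? A) ×-dec ¬? (Y ⊆? B)

crossingEdges : HGraph n → Subset n → Subset n → ℕ
crossingEdges H A B = count (crossingEdge? H A B)

edgesIn-∪ : ∀ {H : HGraph n} {A B} → H ⊥ ≡ false → Disjoint A B →
            edgesIn H (A ∪ B) ≡ edgesIn H A + edgesIn H B + crossingEdges H A B
edgesIn-∪ {H = H} {A} {B} H⊥≡false A∩B≡⊥ = begin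
  edgesIn H (A ∪ B)
    ≡⟨ count-cong (edgeIn? H (A ∪ B)) (λ Y → inside? Y ⊎-dec crossingEdge? H A B Y) (mk⇔ split
         [ [ Data.Product.map₁ (λ Y⊆A → ⊆-trans Y⊆A (p⊆p∪q B))
           , Data.Product.map₁ (λ Y⊆B → ⊆-trans Y⊆B (q⊆p∪q A B)) ]′
         , proj₁ ]′) ⟩
  count (λ Y → inside? Y ⊎-dec crossingEdge? H A B Y)
    ≡⟨ count-⊎ inside? (crossingEdge? H A B)
         [ (λ (Y⊆A , _) (_ , Y⊈A , _) → Y⊈A Y⊆A) , (λ (Y⊆B , _) (_ , _ , Y⊈B) → Y⊈B Y⊆B) ]′ ⟩
  count inside? + crossingEdges H A B
    ≡⟨ cong (_+ crossingEdges H A B) (count-⊎ (edgeIn? H A) (edgeIn? H B)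
         (λ (Y⊆A , HY) (Y⊆B , _) → edge≢⊥ H⊥≡false (T⇒≡ HY) (⊆-disjoint⇒≡⊥ A∩B≡⊥ Y⊆A Y⊆B))) ⟩
  edgesIn H A + edgesIn H B + crossingEdges H A B ∎
  where
  inside? : Decidable (λ Y → EdgeIn H A Y ⊎ EdgeIn H B Y)
  inside? Y = edgeIn? H A Y ⊎-dec edgeIn? H B Y
  split : ∀ {Y} → EdgeIn H (A ∪ B) Y → (EdgeIn H A Y ⊎ EdgeIn H B Y) ⊎ CrossingEdge H A B Y
  split {Y} (Y⊆A∪B , HY) with Y ⊆? A | Y ⊆? B
  ... | yes Y⊆A | _       = inj₁ (inj₁ (Y⊆A , HY))
  ... | no _    | yes Y⊆B = inj₁ (inj₂ (Y⊆B , HY))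
  ... | no Y⊈A  | no Y⊈B  = inj₂ ((Y⊆A∪B , HY) , Y⊈A , Y⊈B)

crossingEdges-mono : ∀ {H : HGraph n} {A B A′ B′} → Disjoint A B → A′ ⊆ A → B′ ⊆ B →
                     crossingEdges H A′ B′ ≤ crossingEdges H A B
crossingEdges-mono {H = H} {A} {B} {A′} {B′} A∩B≡⊥ A′⊆A B′⊆B =
  count-mono (crossingEdge? H A′ B′) (crossingEdge? H A B) λ ((Y⊆A′∪B′ , HY) , Y⊈A′ , Y⊈B′) →
    (⊆-trans Y⊆A′∪B′ (∪-mono-⊆ A′⊆A B′⊆B) , HY)
    , (λ Y⊆A → Y⊈A′ (⊆∪⇒⊆ˡ Y⊆A′∪B′ (λ x∈Y x∈B′ → ∉-disjoint A∩B≡⊥ (Y⊆A x∈Y) (B′⊆B x∈B′))))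
    , (λ Y⊆B → Y⊈B′ (⊆∪⇒⊆ʳ Y⊆A′∪B′ (λ x∈Y x∈A′ → ∉-disjoint A∩B≡⊥ (A′⊆A x∈A′) (Y⊆B x∈Y))))

γ-additive⇔noCrossing : ∀ {H : HGraph n} {A B} → H ⊥ ≡ false → Disjoint A B →
                        (γ H (A ∪ B) ≡ γ H A +ℤ γ H B) ⇔ (crossingEdges H A B ≡ 0)
γ-additive⇔noCrossing {H = H} {A} {B} H⊥≡false A∩B≡⊥ = mk⇔
  (λ γ-additive → m+n≡m⇒n≡0 (edgesIn H A + edgesIn H B)
     (trans (sym (edgesIn-∪ H⊥≡false A∩B≡⊥)) (ℤ.+-injective (begin
       + edgesIn H (A ∪ B)            ≡⟨ γ≡edgesIn H (A ∪ B) ⟨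
       γ H (A ∪ B)                    ≡⟨ γ-additive ⟩
       γ H A +ℤ γ H B                 ≡⟨ cong₂ _+ℤ_ (γ≡edgesIn H A) (γ≡edgesIn H B) ⟩
       + (edgesIn H A + edgesIn H B)  ∎))))
  (λ noCrossing → begin
       γ H (A ∪ B)                    ≡⟨ γ≡edgesIn H (A ∪ B) ⟩
       + edgesIn H (A ∪ B)            ≡⟨ cong +_ (edgesIn-∪ H⊥≡false A∩B≡⊥) ⟩
       + (edgesIn H A + edgesIn H B + crossingEdges H A B)
                                      ≡⟨ cong (λ c → + (edgesIn H A + edgesIn H B + c)) noCrossing ⟩
       + (edgesIn H A + edgesIn H B + 0)
                                      ≡⟨ cong +_ (ℕ.+-identityʳ _) ⟩
       + (edgesIn H A + edgesIn H B)  ≡⟨ cong₂ _+ℤ_ (γ≡edgesIn H A) (γ≡edgesIn H B) ⟨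
       γ H A +ℤ γ H B                 ∎)

Disjoint-mono : ∀ {A B A′ B′ : Subset n} → Disjoint A B → A′ ⊆ A → B′ ⊆ B → Disjoint A′ B′
Disjoint-mono {A′ = A′} {B′} A∩B≡⊥ A′⊆A B′⊆B =
  ⊆-disjoint⇒≡⊥ A∩B≡⊥ (λ x∈ → A′⊆A (p∩q⊆p A′ B′ x∈)) (λ x∈ → B′⊆B (p∩q⊆q A′ B′ x∈))

γ-rigidIndec : ∀ {H : HGraph n} {C} → H ⊥ ≡ false → RigidIndec C (γ H)
γ-rigidIndec {H = H} H⊥≡false A B _ _ A∩B≡⊥ γ-additive A′ B′ A′⊆A B′⊆B =
  Equivalence.from (γ-additive⇔noCrossing H⊥≡false (Disjoint-mono A∩B≡⊥ A′⊆A B′⊆B))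
    (ℕ.n≤0⇒n≡0 (subst (crossingEdges H A′ B′ ≤_)
      (Equivalence.to (γ-additive⇔noCrossing H⊥≡false A∩B≡⊥) γ-additive)
      (crossingEdges-mono A∩B≡⊥ A′⊆A B′⊆B)))

γ-injective : ∀ {X : Subset n} {G H} → IsHG X G → IsHG X H →
              (∀ A → A ⊆ X → γ G A ≡ γ H A) → ∀ A → G A ≡ H A
γ-injective {X = X} {G} {H} hG hH γG≡γH = hypergraph-ext hG hH (All.wfRec ⊂-wellFounded _ _ step)
  where
  step : ∀ A → (∀ {Y} → Y ⊂ A → Y ⊆ X → G Y ≡ H Y) → A ⊆ X → G A ≡ H A
  step A ih A⊆X = edgesIn≡⇒≡ (γ≡⇒edgesIn≡ {G = G} {H} {A} {A} (γG≡γH A A⊆X))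
                             (λ Y⊂A → ih Y⊂A (λ x∈Y → A⊆X (p⊂q⇒p⊆q Y⊂A x∈Y)))

γ-relabel : (π : Permutation m n) (G : HGraph m) (B : Subset n) →
            γ (relabelHG π G) B ≡ relabelBool π (γ G) B
γ-relabel π G B = edgesIn≡⇒γ≡ {G = relabelHG π G} {G} {B} {preimage π B} (begin
  edgesIn (relabelHG π G) B
    ≡⟨ count-cong (edgeIn? (relabelHG π G) B) (edgeIn? G (preimage π B) ∘ preimage π)
         (mk⇔ (Data.Product.map₁ (Equivalence.from (preimage-⊆⇔ π)))
              (Data.Product.map₁ (Equivalence.to (preimage-⊆⇔ π)))) ⟩
  count (edgeIn? G (preimage π B) ∘ preimage π)
    ≡⟨ ∑-reindex (preimage-↔ π) (λ Y → 𝟙 (does (edgeIn? G (preimage π B) Y))) ⟩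
  edgesIn G (preimage π B) ∎)

γ-·HG : ∀ {X Y : Subset n} {G H} → Disjoint X Y → IsHG X G → IsHG Y H →
        ∀ A → γ (G ·HG H) A ≡ star1 X Y (γ G) (γ H) A
γ-·HG {X = X} {Y} {G} {H} X∩Y≡⊥ hG hH A = begin
  γ (G ·HG H) A
    ≡⟨ γ≡edgesIn (G ·HG H) A ⟩
  + edgesIn (G ·HG H) A
    ≡⟨ cong +_ (edgesIn-·HG (λ {Z} GZ HZ → subst T (nonedge-disjoint X∩Y≡⊥ hH (proj₂ hG Z (T⇒≡ GZ))) HZ)) ⟩
  + (edgesIn G A + edgesIn H A)
    ≡⟨ cong₂ (λ a b → + (a + b)) (edgesIn-∩ (proj₂ hG)) (edgesIn-∩ (proj₂ hH)) ⟩
  + edgesIn G (A ∩ X) +ℤ + edgesIn H (A ∩ Y)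
    ≡⟨ cong₂ _+ℤ_ (γ≡edgesIn G (A ∩ X)) (γ≡edgesIn H (A ∩ Y)) ⟨
  γ G (A ∩ X) +ℤ γ H (A ∩ Y) ∎

γ-∣HG : ∀ {Y A : Subset n} {G} → A ⊆ Y → γ (G ∣HG Y) A ≡ γ G A
γ-∣HG {Y = Y} {A} {G} A⊆Y = edgesIn≡⇒γ≡ {G = G ∣HG Y} {G} {A} {A} (edgesIn-∣HG A⊆Y)

Additive : BoolFn n → Set
Additive f = ∀ A B → Disjoint A B → f (A ∪ B) ≡ f A +ℤ f B

additive-tail : ∀ {f : BoolFn (suc n)} → Additive f → Additive (f ∘ (false ∷_))
additive-tail f-additive A B A∩B≡⊥ = f-additive (false ∷ A) (false ∷ B) (cong (false ∷_) A∩B≡⊥)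

additive⇒sumOver : ∀ {f : BoolFn n} {g} → f ⊥ ≡ + 0 → Additive f → (∀ x → f ⁅ x ⁆ ≡ g x) →
                   ∀ A → f A ≡ sumOver A g
additive⇒sumOver {zero} f⊥≡0 _ _ [] = f⊥≡0
additive⇒sumOver {suc n} {f} {g} f⊥≡0 f-additive f⁅⁆≡g (b ∷ A) = head b
  where
  tail : f (false ∷ A) ≡ sumOver A (g ∘ suc)
  tail = additive⇒sumOver {f = f ∘ (false ∷_)} f⊥≡0 (additive-tail {f = f} f-additive) (f⁅⁆≡g ∘ suc) A
  head : ∀ b → f (b ∷ A) ≡ sumOver (b ∷ A) g
  head false = trans tail (sym (ℤ.+-identityˡ _))
  head true  = begin
    f (true ∷ A)                  ≡⟨ cong (λ B → f (true ∷ B)) (∪-identityˡ A) ⟨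
    f ((true ∷ ⊥) ∪ (false ∷ A))  ≡⟨ f-additive (true ∷ ⊥) (false ∷ A) (cong (false ∷_) (∩-zeroˡ A)) ⟩
    f ⁅ zero ⁆ +ℤ f (false ∷ A)   ≡⟨ cong₂ _+ℤ_ (f⁅⁆≡g zero) tail ⟩
    g zero +ℤ sumOver A (g ∘ suc) ∎

allSingletons⇒noCrossingEdges : ∀ {H : HGraph n} {A B} → AllSingletons H → crossingEdges H A B ≡ 0
allSingletons⇒noCrossingEdges {H = H} {A} {B} singletons = count-≡0 (crossingEdge? H A B)
  λ {Y} ((Y⊆A∪B , HY) , Y⊈A , Y⊈B) →
    [ Y⊈A , Y⊈B ]′ (singleton-⊆∪ (singletons Y (T⇒≡ HY)) Y⊆A∪B)
  where
  singleton-⊆∪ : ∀ {Y} → ∣ Y ∣ ≡ 1 → Y ⊆ A ∪ B → Y ⊆ A ⊎ Y ⊆ B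
  singleton-⊆∪ {Y} ∣Y∣≡1 Y⊆A∪B with ∣p∣≡1⇒≡⁅x⁆ {p = Y} ∣Y∣≡1
  ... | x , refl = Data.Sum.map x∈p⇒⁅x⁆⊆p x∈p⇒⁅x⁆⊆p (x∈p∪q⁻ A B (Y⊆A∪B (x∈⁅x⁆ x)))

γ-sumOver-singletons : ∀ {H : HGraph n} {g} → H ⊥ ≡ false → AllSingletons H →
                       (∀ x → γ H ⁅ x ⁆ ≡ g x) → ∀ A → γ H A ≡ sumOver A g
γ-sumOver-singletons {H = H} H⊥≡false singletons =
  additive⇒sumOver (trans (γ≡edgesIn H ⊥) (cong +_ (edgesIn-⊥ {H = H} H⊥≡false)))
    (λ A B A∩B≡⊥ → Equivalence.from (γ-additive⇔noCrossing H⊥≡false A∩B≡⊥) (allSingletons⇒noCrossingEdges singletons))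

isSingleton : Subset n → Bool
isSingleton Y = ∣ Y ∣ ≡ᵇ 1

singletonEdges otherEdges : HGraph n → HGraph n
singletonEdges H Y = H Y ∧ isSingleton Y
otherEdges     H Y = H Y ∧ not (isSingleton Y)

edgesIn-singleton+other : (H : HGraph n) (A : Subset n) →
                          edgesIn H A ≡ edgesIn (singletonEdges H) A + edgesIn (otherEdges H) A
edgesIn-singleton+other H A = trans (edgesIn-cong {A = A} split) (edgesIn-·HG {A = A} disjoint)
  where
  split : ∀ Y → H Y ≡ (singletonEdges H ·HG otherEdges H) Y
  split Y with H Y | isSingleton Y
  ... | true  | true  = refl
  ... | true  | false = refl
  ... | false | _     = refl
  disjoint : ∀ {Y} → T (singletonEdges H Y) → ¬ T (otherEdges H Y)
  disjoint {Y} with H Y | isSingleton Y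
  ... | true | true  = λ _ ()
  ... | true | false = λ ()

singletonEdges-singletons : ∀ {H : HGraph n} → AllSingletons (singletonEdges H)
singletonEdges-singletons Y HY∧s = ℕ.≡ᵇ⇒≡ ∣ Y ∣ 1 (proj₂ (Equivalence.to T-∧ (≡⇒T HY∧s)))

edge⊆⁅x⁆⇒singleton : ∀ {H : HGraph n} {Y x} → H ⊥ ≡ false → H Y ≡ true → Y ⊆ ⁅ x ⁆ → ∣ Y ∣ ≡ 1
edge⊆⁅x⁆⇒singleton {x = x} H⊥≡false HY Y⊆⁅x⁆ with ⊆⁅x⁆⇒≡⊥⊎≡⁅x⁆ Y⊆⁅x⁆
... | inj₁ Y≡⊥  = contradiction Y≡⊥ (edge≢⊥ H⊥≡false HY)
... | inj₂ refl = ∣⁅x⁆∣≡1 x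

γ-singletonEdges-⁅⁆ : ∀ {H : HGraph n} → H ⊥ ≡ false → ∀ x → γ (singletonEdges H) ⁅ x ⁆ ≡ γ H ⁅ x ⁆
γ-singletonEdges-⁅⁆ {H = H} H⊥≡false x = edgesIn≡⇒γ≡ {G = singletonEdges H} {H} {⁅ x ⁆} {⁅ x ⁆}
  (count-cong (edgeIn? (singletonEdges H) ⁅ x ⁆) (edgeIn? H ⁅ x ⁆)
    (mk⇔ (Data.Product.map₂ (proj₁ ∘ Equivalence.to T-∧)) singleton))
  where
  singleton : ∀ {Y} → EdgeIn H ⁅ x ⁆ Y → EdgeIn (singletonEdges H) ⁅ x ⁆ Y
  singleton {Y} (Y⊆⁅x⁆ , HY) = Y⊆⁅x⁆ , Equivalence.from T-∧
    (HY , ℕ.≡⇒≡ᵇ ∣ Y ∣ 1 (edge⊆⁅x⁆⇒singleton H⊥≡false (T⇒≡ HY) Y⊆⁅x⁆))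

-- A non-singleton edge Z is counted by γ H Z but not by γ (singletonEdges H) Z, although both
-- functions would be modular on X with the same values on singletons.
γ-modular⇔allSingletons : ∀ {X : Subset n} {H} → IsHG X H → Modular X (γ H) ⇔ AllSingletons H
γ-modular⇔allSingletons {X = X} {H} (H⊥≡false , edges⊆X) = mk⇔ modular⇒singletons
  (λ singletons A _ → γ-sumOver-singletons H⊥≡false singletons (λ _ → refl) A)
  where
  modular⇒singletons : Modular X (γ H) → AllSingletons H
  modular⇒singletons modular Z HZ with isSingleton Z in singletonZ
  ... | true  = ℕ.≡ᵇ⇒≡ ∣ Z ∣ 1 (≡⇒T singletonZ)
  ... | false = contradiction otherEdgesIn≡0
                  (ℕ.>⇒≢ (edgesIn-pos {H = otherEdges H} {Z} {Z} otherZ λ x∈Z → x∈Z))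
    where
    otherZ : otherEdges H Z ≡ true
    otherZ = cong₂ _∧_ HZ (cong not singletonZ)
    e₁ e₂ : ℕ
    e₁ = edgesIn (singletonEdges H) Z
    e₂ = edgesIn (otherEdges H) Z
    otherEdgesIn≡0 : e₂ ≡ 0
    otherEdgesIn≡0 = m+n≡m⇒n≡0 e₁ (ℤ.+-injective (begin
      + (e₁ + e₂)                    ≡⟨ cong +_ (edgesIn-singleton+other H Z) ⟨
      + edgesIn H Z                  ≡⟨ γ≡edgesIn H Z ⟨
      γ H Z                          ≡⟨ modular Z (edges⊆X Z HZ) ⟩
      sumOver Z (λ x → γ H ⁅ x ⁆)    ≡⟨ γ-sumOver-singletons (cong (_∧ _) H⊥≡false) singletonEdges-singletons
                                          (γ-singletonEdges-⁅⁆ H⊥≡false) Z ⟨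
      γ (singletonEdges H) Z         ≡⟨ γ≡edgesIn (singletonEdges H) Z ⟩
      + e₁                           ∎))

proposition4p16 :
    -- (a) ι
    ( (∀ n (X : Subset n) (G H : HGraph n) → IsHG X G → IsHG X H →
         (∀ A → A ⊆ X → ι G A ≡ ι H A) → ∀ A → G A ≡ H A)
    × (∀ m n (π : Permutation m n) (X : Subset m) (G : HGraph m) → IsHG X G →
         ∀ B → B ⊆ image π X → ι (relabelHG π G) B ≡ relabelBool π (ι G) B)
    × (∀ n (X Y : Subset n) (G H : HGraph n) → Disjoint X Y → IsHG X G → IsHG Y H →
         ∀ A → A ⊆ (X ∪ Y) → ι (G ·HG H) A ≡ star0 X Y (ι G) (ι H) A)
    × (∀ n (X Y : Subset n) (G : HGraph n) → IsHG X G → Y ⊆ X →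
         ∀ A → A ⊆ Y → ι (G ∣HG Y) A ≡ ι G A) )
    -- (b) γ
    × ( (∀ n (X : Subset n) (H : HGraph n) → IsHG X H → Rigid X (γ H))
    × (∀ n (X : Subset n) (G H : HGraph n) → IsHG X G → IsHG X H →
         (∀ A → A ⊆ X → γ G A ≡ γ H A) → ∀ A → G A ≡ H A)
    × (∀ m n (π : Permutation m n) (X : Subset m) (G : HGraph m) → IsHG X G →
         ∀ B → B ⊆ image π X → γ (relabelHG π G) B ≡ relabelBool π (γ G) B)
    × (∀ n (X Y : Subset n) (G H : HGraph n) → Disjoint X Y → IsHG X G → IsHG Y H →
         ∀ A → A ⊆ (X ∪ Y) → γ (G ·HG H) A ≡ star1 X Y (γ G) (γ H) A)
    × (∀ n (X Y : Subset n) (G : HGraph n) → IsHG X G → Y ⊆ X →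
         ∀ A → A ⊆ Y → γ (G ∣HG Y) A ≡ γ G A) )
    -- (c) εδ(γ(H)) = εδ(H)
    × (∀ n (X : Subset n) (H : HGraph n) → IsHG X H →
         Modular X (γ H) ⇔ AllSingletons H)
proposition4p16 =
  ( ( (λ _ _ _ _ → ι-injective)
    , (λ _ _ _ _ _ _ _ _ → refl)
    , (λ _ _ _ _ _ X∩Y≡⊥ hG hH A _ → ι-·HG X∩Y≡⊥ hG hH A)
    , (λ _ _ Y G _ _ _ A⊆Y → ι-∣HG {Y = Y} {G = G} A⊆Y) )
  , ( (λ _ _ _ (H⊥≡false , _) _ _ → γ-rigidIndec H⊥≡false)
    , (λ _ _ _ _ → γ-injective)
    , (λ _ _ π _ G _ B _ → γ-relabel π G B)
    , (λ _ _ _ _ _ X∩Y≡⊥ hG hH A _ → γ-·HG X∩Y≡⊥ hG hH A)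
    , (λ _ _ Y G _ _ _ A⊆Y → γ-∣HG {Y = Y} {G = G} A⊆Y) )
  , (λ _ _ _ → γ-modular⇔allSingletons) )
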